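{- Let $k\ge 2$ be an integer and let $p_{ -k}(n)$ denote the number of $k$-colored partitions of $n$. For any positive integers $a\ge b$, $$p_{ -k}(a)\,p_{ -k}(b)>p_{ -k}(a+b),$$ except for $(a,b,k)\in\{(1,1,2),(2,1,2),(3,1,2),(1,1,3)\}$.
   Context: A $k$-colored partition of a nonnegative integer $n$ is a partition of $n$ in which each part is assigned one of $k$ colors $1,\dots,k$; two $k$-colored partitions are the same if they have the same multiset of (size, color) pairs. Equivalently, $\sum_{n\ge0}p_{ -k}(n)q^n=\prod_{m\ge1}(1-q^m)^{ -k}$. -}

module Defs where

open import Data.Nat using (ℕ; zero; suc; _+_; _*_; _∸_; _≤?_)
open import Data.List using (List; []; _∷_; _++_; replicate)
open import Relation.Nullary using (yes; no)

-- A k-colored partition of n is a finite multiset of pairs (part size m ≥ 1,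
-- colour c ∈ {1..k}) whose sizes sum to n.  Such a multiset is determined by
-- the multiplicity of each "type" (m, c).  Types with m > n cannot occur.

-- part sizes of all types (m, c) with 1 ≤ m ≤ n and c ∈ {1..k}:
-- each size m appears k times (once per colour).
types : ℕ → ℕ → List ℕ
types k zero    = []
types k (suc n) = replicate k (suc n) ++ types k n

-- ways ts n = number of functions assigning a multiplicity j_t ≥ 0 to each
-- type t in the list ts (a list of positive part sizes) with Σ j_t * t = n.
-- Multiplicities are bounded by n since every part size is ≥ 1.
sumUpTo : ℕ → (ℕ → ℕ) → ℕ
sumUpTo zero    f = f zero
sumUpTo (suc N) f = sumUpTo N f + f (suc N)

ways : List ℕ → ℕ → ℕ
ways []       zero    = 1
ways []       (suc n) = 0
ways (m ∷ ms) n = sumUpTo n λ j → term j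
  where
  term : ℕ → ℕ
  term j with j * m ≤? n
  ... | yes _ = ways ms (n ∸ j * m)
  ... | no  _ = 0

p- : ℕ → ℕ → ℕ
p- k n = ways (types k n) n

-- Taking the logarithmic derivative of ∏ (1 − q^m)^(−k) gives the recurrence
-- n·p(n) = k Σ_{j=1}^{n} σ(j)·p(n − j), where σ is the divisor sum. It follows from the counting
-- definition by adjoining part sizes one at a time, since dividing a generating function by
-- 1 − q^m adds m·[m ∣ y] to the coefficients of its logarithmic derivative. Splitting the sum at j = a,
-- (a + b)·p(a + b) = k (Σ_{j ≤ a} σ(j) p(a + b − j) + Σ_{i ≤ b} σ(a + i) p(b − i)).
-- By strong induction on a + b, the weak inequality p(a − j + b) ≤ p(a − j) p(b) bounds the first
-- sum by p(b)·a p(a)/k, and σ(a + i) < σ(i) p(a) bounds the second strictly by p(a)·b p(b)/k; the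
-- latter follows from i ≤ σ(i), σ(n) ≤ n(n + 1)/2 and the lower bound p(n) ≥ (n+1)(n+2)(n+3)/18,
-- which the recurrence also yields. When k = 2 and b = 1 the weak inequality is unavailable at
-- j = a − 1; there the terms j ≥ a − 1 are estimated directly for a ≥ 13, and a ≤ 12 is computed.

module Submission where

open import Defs
open import Data.Nat using (ℕ; _≤_; _<_; _*_; _+_)
open import Data.Product using (_×_)
open import Data.Sum using (_⊎_)
open import Relation.Binary.PropositionalEquality using (_≡_)
open import Relation.Nullary using (¬_)

open import Data.Nat using (zero; suc; _∸_; _≤?_; _≟_; z≤n; s≤s; NonZero; >-nonZero)
open import Data.Nat.Properties
open import Data.Nat.Divisibility using (_∣_; _∣?_; divides; ∣-refl; ∣⇒≤; ∣1⇒≡1; ∣m+n∣m⇒∣n)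
open import Data.Nat.Tactic.RingSolver using (solve-∀)
open import Data.List using (List; []; _∷_; _++_; replicate)
open import Data.List.Relation.Unary.All using (All; []; _∷_)
open import Data.List.Relation.Unary.All.Properties using (++⁺; replicate⁺)
open import Data.Product using (_,_; proj₁; proj₂)
open import Data.Sum using (inj₁; inj₂)
open import Function using (_∘_)
open import Algebra.Properties.CommutativeSemigroup +-commutativeSemigroup using () renaming (interchange to +-interchange)
open import Relation.Binary.PropositionalEquality using (_≢_; refl; sym; trans; cong; cong₂; subst; subst₂; module ≡-Reasoning)
open import Relation.Nullary using (Dec; yes; no; contradiction)
open import Relation.Nullary.Decidable using (True; toWitness; _×-dec_; _⊎-dec_)
open import Data.Nat.Induction using (<-rec)

-- Iverson brackets and finite sums

when : {P : Set} → Dec P → ℕ → ℕ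
when (yes _) x = x
when (no _)  _ = 0

when-true : ∀ {P : Set} (P? : Dec P) {x} → P → when P? x ≡ x
when-true (yes _) _ = refl
when-true (no ¬p) p = contradiction p ¬p

when-false : ∀ {P : Set} (P? : Dec P) {x} → ¬ P → when P? x ≡ 0
when-false (yes p) ¬p = contradiction p ¬p
when-false (no _)  _  = refl

*-distribˡ-when : ∀ {P : Set} (P? : Dec P) c x → c * when P? x ≡ when P? (c * x)
*-distribˡ-when (yes _) c x = refl
*-distribˡ-when (no _)  c x = *-zeroʳ c

when-+ : ∀ {P : Set} (P? : Dec P) x y → when P? (x + y) ≡ when P? x + when P? y
when-+ (yes _) x y = refl
when-+ (no _)  x y = refl

when-congʳ : ∀ {P : Set} (P? : Dec P) {x y} → (P → x ≡ y) → when P? x ≡ when P? y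
when-congʳ (yes p) x≡y = x≡y p
when-congʳ (no _)  _   = refl

when-cong : ∀ {P Q : Set} (P? : Dec P) (Q? : Dec Q) {x y} →
            (P → Q) → (Q → P) → (P → x ≡ y) → when P? x ≡ when Q? y
when-cong (yes p) (yes _) _   _   x≡y = x≡y p
when-cong (yes p) (no ¬q) P→Q _   _   = contradiction (P→Q p) ¬q
when-cong (no ¬p) (yes q) _   Q→P _   = contradiction (Q→P q) ¬p
when-cong (no _)  (no _)  _   _   _   = refl

when-≤ : ∀ {P : Set} (P? : Dec P) x → when P? x ≤ x
when-≤ (yes _) x = ≤-refl
when-≤ (no _)  x = z≤n

when-* : ∀ {P : Set} (P? : Dec P) x y → when P? x * y ≡ when P? (x * y)
when-* (yes _) x y = refl
when-* (no _)  x y = refl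

sum⁺ : ℕ → (ℕ → ℕ) → ℕ
sum⁺ zero    f = 0
sum⁺ (suc n) f = sum⁺ n f + f (suc n)

module _ {f g : ℕ → ℕ} where

  sum⁺-cong : ∀ n → (∀ i → 1 ≤ i → i ≤ n → f i ≡ g i) → sum⁺ n f ≡ sum⁺ n g
  sum⁺-cong zero    _  = refl
  sum⁺-cong (suc n) eq =
    cong₂ _+_ (sum⁺-cong n λ i 1≤i i≤n → eq i 1≤i (m≤n⇒m≤1+n i≤n)) (eq (suc n) (s≤s z≤n) ≤-refl)

  sumUpTo-cong : ∀ n → (∀ i → i ≤ n → f i ≡ g i) → sumUpTo n f ≡ sumUpTo n g
  sumUpTo-cong zero    eq = eq 0 z≤n
  sumUpTo-cong (suc n) eq =
    cong₂ _+_ (sumUpTo-cong n λ i i≤n → eq i (m≤n⇒m≤1+n i≤n)) (eq (suc n) ≤-refl)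

  sum⁺-mono-≤ : ∀ n → (∀ i → 1 ≤ i → i ≤ n → f i ≤ g i) → sum⁺ n f ≤ sum⁺ n g
  sum⁺-mono-≤ zero    _  = z≤n
  sum⁺-mono-≤ (suc n) le =
    +-mono-≤ (sum⁺-mono-≤ n λ i 1≤i i≤n → le i 1≤i (m≤n⇒m≤1+n i≤n)) (le (suc n) (s≤s z≤n) ≤-refl)

  sum⁺-mono-< : ∀ n → 1 ≤ n → (∀ i → 1 ≤ i → i ≤ n → f i < g i) → sum⁺ n f < sum⁺ n g
  sum⁺-mono-< (suc n) _ lt =
    +-mono-≤-< (sum⁺-mono-≤ n λ i 1≤i i≤n → <⇒≤ (lt i 1≤i (m≤n⇒m≤1+n i≤n))) (lt (suc n) (s≤s z≤n) ≤-refl)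

  sum⁺-+ : ∀ n → sum⁺ n (λ i → f i + g i) ≡ sum⁺ n f + sum⁺ n g
  sum⁺-+ zero    = refl
  sum⁺-+ (suc n) =
    trans (cong (_+ (f (suc n) + g (suc n))) (sum⁺-+ n)) (+-interchange (sum⁺ n f) (sum⁺ n g) _ _)

  sumUpTo-+ : ∀ n → sumUpTo n (λ i → f i + g i) ≡ sumUpTo n f + sumUpTo n g
  sumUpTo-+ zero    = refl
  sumUpTo-+ (suc n) =
    trans (cong (_+ (f (suc n) + g (suc n))) (sumUpTo-+ n)) (+-interchange (sumUpTo n f) (sumUpTo n g) _ _)

module _ (f : ℕ → ℕ) where

  sum⁺-zero : ∀ n → (∀ i → 1 ≤ i → i ≤ n → f i ≡ 0) → sum⁺ n f ≡ 0
  sum⁺-zero zero    _  = refl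
  sum⁺-zero (suc n) z≡ =
    cong₂ _+_ (sum⁺-zero n λ i 1≤i i≤n → z≡ i 1≤i (m≤n⇒m≤1+n i≤n)) (z≡ (suc n) (s≤s z≤n) ≤-refl)

  sumUpTo-zero : ∀ n → (∀ i → i ≤ n → f i ≡ 0) → sumUpTo n f ≡ 0
  sumUpTo-zero zero    z≡ = z≡ 0 z≤n
  sumUpTo-zero (suc n) z≡ = cong₂ _+_ (sumUpTo-zero n λ i i≤n → z≡ i (m≤n⇒m≤1+n i≤n)) (z≡ (suc n) ≤-refl)

  *-distribˡ-sum⁺ : ∀ c n → c * sum⁺ n f ≡ sum⁺ n (λ i → c * f i)
  *-distribˡ-sum⁺ c zero    = *-zeroʳ c
  *-distribˡ-sum⁺ c (suc n) = trans (*-distribˡ-+ c _ _) (cong (_+ c * f (suc n)) (*-distribˡ-sum⁺ c n))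

  *-distribˡ-sumUpTo : ∀ c n → c * sumUpTo n f ≡ sumUpTo n (λ i → c * f i)
  *-distribˡ-sumUpTo c zero    = refl
  *-distribˡ-sumUpTo c (suc n) = trans (*-distribˡ-+ c _ _) (cong (_+ c * f (suc n)) (*-distribˡ-sumUpTo c n))

  sumUpTo≡head+sum⁺ : ∀ n → sumUpTo n f ≡ f 0 + sum⁺ n f
  sumUpTo≡head+sum⁺ zero    = sym (+-identityʳ (f 0))
  sumUpTo≡head+sum⁺ (suc n) = trans (cong (_+ f (suc n)) (sumUpTo≡head+sum⁺ n)) (+-assoc (f 0) _ _)

  sum⁺-suc : ∀ n → sum⁺ (suc n) f ≡ f 1 + sum⁺ n (f ∘ suc)
  sum⁺-suc zero    = +-comm 0 (f 1)
  sum⁺-suc (suc n) = trans (cong (_+ f (2 + n)) (sum⁺-suc n)) (+-assoc (f 1) _ _)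

  sum⁺-+-range : ∀ a b → sum⁺ (a + b) f ≡ sum⁺ a f + sum⁺ b (λ i → f (a + i))
  sum⁺-+-range a zero    = trans (cong (λ n → sum⁺ n f) (+-identityʳ a)) (sym (+-identityʳ _))
  sum⁺-+-range a (suc b) rewrite +-suc a b =
    trans (cong (_+ f (suc (a + b))) (sum⁺-+-range a b)) (+-assoc (sum⁺ a f) _ _)

  sum⁺-extend : ∀ {n} N → n ≤ N → (∀ i → n < i → i ≤ N → f i ≡ 0) → sum⁺ N f ≡ sum⁺ n f
  sum⁺-extend {n} zero    z≤n  _  = refl
  sum⁺-extend {n} (suc N) n≤N z≡ with n ≟ suc N
  ... | yes refl = refl
  ... | no  n≢N  = begin
    sum⁺ N f + f (suc N) ≡⟨ cong₂ _+_ (sum⁺-extend N n≤N′ λ i n<i i≤N → z≡ i n<i (m≤n⇒m≤1+n i≤N))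
                                      (z≡ (suc N) (s≤s n≤N′) ≤-refl) ⟩
    sum⁺ n f + 0         ≡⟨ +-identityʳ _ ⟩
    sum⁺ n f             ∎
    where
    open ≡-Reasoning
    n≤N′ : n ≤ N
    n≤N′ = ≤-pred (≤∧≢⇒< n≤N n≢N)

  sumUpTo-extend : ∀ {n} N → n ≤ N → (∀ i → n < i → i ≤ N → f i ≡ 0) → sumUpTo N f ≡ sumUpTo n f
  sumUpTo-extend {n} N n≤N z≡ = begin
    sumUpTo N f      ≡⟨ sumUpTo≡head+sum⁺ N ⟩
    f 0 + sum⁺ N f   ≡⟨ cong (f 0 +_) (sum⁺-extend N n≤N z≡) ⟩
    f 0 + sum⁺ n f   ≡⟨ sym (sumUpTo≡head+sum⁺ n) ⟩
    sumUpTo n f      ∎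
    where open ≡-Reasoning

sum⁺-const : ∀ n x → sum⁺ n (λ _ → x) ≡ n * x
sum⁺-const zero    x = refl
sum⁺-const (suc n) x = trans (cong (_+ x) (sum⁺-const n x)) (+-comm (n * x) x)

sum⁺-comm : ∀ n N (F : ℕ → ℕ → ℕ) → sum⁺ n (λ i → sum⁺ N (F i)) ≡ sum⁺ N (λ j → sum⁺ n (λ i → F i j))
sum⁺-comm zero    N F = sym (sum⁺-zero (λ _ → 0) N λ _ _ _ → refl)
sum⁺-comm (suc n) N F = trans (cong (_+ sum⁺ N (F (suc n))) (sum⁺-comm n N F)) (sym (sum⁺-+ N))

sum⁺-sumUpTo-comm : ∀ n N (F : ℕ → ℕ → ℕ) →
                    sum⁺ n (λ i → sumUpTo N (F i)) ≡ sumUpTo N (λ j → sum⁺ n (λ i → F i j))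
sum⁺-sumUpTo-comm zero    N F = sym (sumUpTo-zero (λ _ → 0) N λ _ _ → refl)
sum⁺-sumUpTo-comm (suc n) N F =
  trans (cong (_+ sumUpTo N (F (suc n))) (sum⁺-sumUpTo-comm n N F)) (sym (sumUpTo-+ N))

sum⁺-indicator : ∀ {x} → 1 ≤ x → ∀ n (F : ℕ → ℕ) → sum⁺ n (λ i → when (i ≟ x) (F i)) ≡ when (x ≤? n) (F x)
sum⁺-indicator {x} 1≤x zero    F = sym (when-false (x ≤? 0) (<⇒≱ 1≤x))
sum⁺-indicator {x} 1≤x (suc n) F with suc n ≟ x
... | yes refl = begin
  sum⁺ n (λ i → when (i ≟ suc n) (F i)) + F (suc n) ≡⟨ cong (_+ F (suc n)) (sum⁺-indicator 1≤x n F) ⟩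
  when (suc n ≤? n) (F (suc n)) + F (suc n)          ≡⟨ cong (_+ F (suc n)) (when-false (suc n ≤? n) (n≮n n)) ⟩
  F (suc n)                                          ≡⟨ sym (when-true (suc n ≤? suc n) ≤-refl) ⟩
  when (suc n ≤? suc n) (F (suc n))                  ∎
  where open ≡-Reasoning
... | no  n≢x  = begin
  sum⁺ n (λ i → when (i ≟ x) (F i)) + 0 ≡⟨ +-identityʳ _ ⟩
  sum⁺ n (λ i → when (i ≟ x) (F i))     ≡⟨ sum⁺-indicator 1≤x n F ⟩
  when (x ≤? n) (F x)                   ≡⟨ when-cong (x ≤? n) (x ≤? suc n) m≤n⇒m≤1+n
                                             (λ x≤1+n → ≤-pred (≤∧≢⇒< x≤1+n (n≢x ∘ sym))) (λ _ → refl) ⟩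
  when (x ≤? suc n) (F x)               ∎
  where open ≡-Reasoning

∸-comm : ∀ n a b → n ∸ a ∸ b ≡ n ∸ b ∸ a
∸-comm n a b = trans (∸-+-assoc n a b) (trans (cong (n ∸_) (+-comm a b)) (sym (∸-+-assoc n b a)))

≤∸⇒≤∸ : ∀ {a y n} → y ≤ n → a ≤ n ∸ y → y ≤ n ∸ a
≤∸⇒≤∸ {a} {y} {n} y≤n a≤n∸y = m+n≤o⇒m≤o∸n y (subst (_≤ n) (+-comm a y) (m≤o∸n⇒m+n≤o a y≤n a≤n∸y))

n∸j<n : ∀ {n j} → 1 ≤ j → j ≤ n → n ∸ j < n
n∸j<n {n} {j} 1≤j j≤n = ∸-monoʳ-< {n} {j} {0} 1≤j j≤n

≤-by-computation : ∀ {m n} → True (m ≤? n) → m ≤ n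
≤-by-computation = toWitness

sum⁺-index-weighted : ∀ n (H : ℕ → ℕ) →
  sum⁺ n (λ l → l * H l) ≡ sum⁺ n (λ i → sumUpTo (n ∸ i) (λ j → H (i + j)))
sum⁺-index-weighted zero    H = refl
sum⁺-index-weighted (suc n) H = begin
  sum⁺ n (λ l → l * H l) + (H (suc n) + n * H (suc n))
    ≡⟨ cong (_+ (H (suc n) + n * H (suc n))) (sum⁺-index-weighted n H) ⟩
  tails n + (H (suc n) + n * H (suc n))
    ≡⟨ cong (λ x → tails n + (H (suc n) + x)) (sym (sum⁺-const n (H (suc n)))) ⟩
  tails n + (H (suc n) + sum⁺ n (λ _ → H (suc n)))
    ≡⟨ rearrange (tails n) (H (suc n)) _ ⟩
  (tails n + sum⁺ n (λ _ → H (suc n))) + H (suc n)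
    ≡⟨ cong₂ _+_ (sym (sum⁺-+ n)) (sym last) ⟩
  sum⁺ n (λ i → sumUpTo (n ∸ i) (λ j → H (i + j)) + H (suc n)) + sumUpTo (n ∸ n) (λ j → H (suc n + j))
    ≡⟨ cong (_+ sumUpTo (n ∸ n) (λ j → H (suc n + j))) (sum⁺-cong n λ i _ i≤n → sym (grow i i≤n)) ⟩
  sum⁺ n (λ i → sumUpTo (suc n ∸ i) (λ j → H (i + j))) + sumUpTo (n ∸ n) (λ j → H (suc n + j)) ∎
  where
  open ≡-Reasoning
  tails : ℕ → ℕ
  tails n = sum⁺ n (λ i → sumUpTo (n ∸ i) (λ j → H (i + j)))
  rearrange : ∀ a b c → a + (b + c) ≡ (a + c) + b
  rearrange = solve-∀
  last : sumUpTo (n ∸ n) (λ j → H (suc n + j)) ≡ H (suc n)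
  last = trans (cong (λ t → sumUpTo t (λ j → H (suc n + j))) (n∸n≡0 n)) (cong H (+-identityʳ (suc n)))
  grow : ∀ i → i ≤ n → sumUpTo (suc n ∸ i) (λ j → H (i + j)) ≡ sumUpTo (n ∸ i) (λ j → H (i + j)) + H (suc n)
  grow i i≤n = trans (cong (λ t → sumUpTo t (λ j → H (i + j))) (+-∸-assoc 1 i≤n))
                     (cong (λ t → sumUpTo (n ∸ i) (λ j → H (i + j)) + H t)
                           (trans (+-suc i (n ∸ i)) (cong suc (m+[n∸m]≡n i≤n))))

module _ (m : ℕ) .{{_ : NonZero m}} where

  multiples-count : ∀ n x {y} → 1 ≤ y → y ≤ n → sum⁺ n (λ i → when (y ≟ i * m) x) ≡ when (m ∣? y) x
  multiples-count n x {y} 1≤y y≤n with m ∣? y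
  ... | yes (divides q y≡qm) = begin
    sum⁺ n (λ i → when (y ≟ i * m) x)
      ≡⟨ sum⁺-cong n (λ i _ _ → when-cong (y ≟ i * m) (i ≟ q)
           (λ y≡im → *-cancelʳ-≡ i q m (trans (sym y≡im) y≡qm))
           (λ i≡q → trans y≡qm (cong (_* m) (sym i≡q))) (λ _ → refl)) ⟩
    sum⁺ n (λ i → when (i ≟ q) x)  ≡⟨ sum⁺-indicator 1≤q n (λ _ → x) ⟩
    when (q ≤? n) x                ≡⟨ when-true (q ≤? n) (≤-trans (m≤m*n q m) (subst (_≤ n) y≡qm y≤n)) ⟩
    x                              ∎
    where
    open ≡-Reasoning
    1≤q : 1 ≤ q
    1≤q = n≢0⇒n>0 λ q≡0 → m<n⇒n≢0 1≤y (trans y≡qm (cong (_* m) q≡0))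
  ... | no m∤y = sum⁺-zero _ n λ i _ _ → when-false (y ≟ i * m) λ y≡im → m∤y (divides i y≡im)

  sum⁺-multiples : ∀ n (F : ℕ → ℕ) →
    sum⁺ n (λ i → when (i * m ≤? n) (F (i * m))) ≡ sum⁺ n (λ y → when (m ∣? y) (F y))
  sum⁺-multiples n F = begin
    sum⁺ n (λ i → when (i * m ≤? n) (F (i * m)))
      ≡⟨ sum⁺-cong n (λ i 1≤i _ → sym (sum⁺-indicator (≤-trans 1≤i (m≤m*n i m)) n F)) ⟩
    sum⁺ n (λ i → sum⁺ n (λ y → when (y ≟ i * m) (F y)))
      ≡⟨ sum⁺-comm n n (λ i y → when (y ≟ i * m) (F y)) ⟩
    sum⁺ n (λ y → sum⁺ n (λ i → when (y ≟ i * m) (F y)))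
      ≡⟨ sum⁺-cong n (λ y 1≤y y≤n → multiples-count n (F y) 1≤y y≤n) ⟩
    sum⁺ n (λ y → when (m ∣? y) (F y)) ∎
    where open ≡-Reasoning

-- The logarithmic derivative of a partition generating function

-- addPart m V lists the coefficients of V(q)/(1 − q^m): n is split into j parts of size m
-- and a rest counted by V.
addPart : ℕ → (ℕ → ℕ) → ℕ → ℕ
addPart m V n = sumUpTo n (λ j → when (j * m ≤? n) (V (n ∸ j * m)))

mutual
  ways-∷ : ∀ m ms n → ways (m ∷ ms) n ≡ addPart m (ways ms) n
  ways-∷ m ms n = sumUpTo-cong n λ j _ → ways-summand m ms n j

  -- The left side is the with-abstracted summand in the definition of ways, which has no name;
  -- it is solved from the use above.
  ways-summand : ∀ m ms n j → _ ≡ when (j * m ≤? n) (ways ms (n ∸ j * m))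
  ways-summand m ms n j with j * m ≤? n
  ... | yes _ = refl
  ... | no  _ = refl

-- n·V(n) = Σ_{y=1}^{n} c(y)·V(n − y), that is, q V′(q) = C(q) V(q) for the generating functions.
LogDerivative : (ℕ → ℕ) → (ℕ → ℕ) → Set
LogDerivative c V = ∀ n → n * V n ≡ sum⁺ n (λ y → c y * V (n ∸ y))

module _ (m : ℕ) .{{_ : NonZero m}} (V : ℕ → ℕ) where

  addPart-extend : ∀ {n} N → n ≤ N → sumUpTo N (λ j → when (j * m ≤? n) (V (n ∸ j * m))) ≡ addPart m V n
  addPart-extend {n} N n≤N = sumUpTo-extend _ N n≤N λ j n<j _ →
    when-false (j * m ≤? n) λ jm≤n → <⇒≱ n<j (≤-trans (m≤m*n j m) jm≤n)

  addPart-restWeighted : ∀ {c} → LogDerivative c V → ∀ n →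
    sumUpTo n (λ j → when (j * m ≤? n) ((n ∸ j * m) * V (n ∸ j * m))) ≡ sum⁺ n (λ y → c y * addPart m V (n ∸ y))
  addPart-restWeighted {c} V′ n = begin
    sumUpTo n (λ j → when (j * m ≤? n) ((n ∸ j * m) * V (n ∸ j * m)))
      ≡⟨ sumUpTo-cong n (λ j _ → expand j) ⟩
    sumUpTo n (λ j → sum⁺ n (λ y → c y * W y j))
      ≡⟨ sym (sum⁺-sumUpTo-comm n n (λ y j → c y * W y j)) ⟩
    sum⁺ n (λ y → sumUpTo n (λ j → c y * W y j))
      ≡⟨ sum⁺-cong n (λ y _ y≤n → sym (trans (cong (c y *_) (sym (addPart-extend n (m∸n≤m n y))))
                                             (*-distribˡ-sumUpTo (W y) (c y) n))) ⟩
    sum⁺ n (λ y → c y * addPart m V (n ∸ y)) ∎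
    where
    open ≡-Reasoning
    W : ℕ → ℕ → ℕ
    W y j = when (j * m ≤? n ∸ y) (V (n ∸ y ∸ j * m))
    expand : ∀ j → when (j * m ≤? n) ((n ∸ j * m) * V (n ∸ j * m)) ≡ sum⁺ n (λ y → c y * W y j)
    expand j with j * m ≤? n
    ... | yes jm≤n = begin
      (n ∸ j * m) * V (n ∸ j * m)                   ≡⟨ V′ (n ∸ j * m) ⟩
      sum⁺ (n ∸ j * m) (λ y → c y * V (n ∸ j * m ∸ y))
        ≡⟨ sum⁺-cong (n ∸ j * m) (λ y _ y≤ → cong (c y *_) (sym (trans
             (when-true (j * m ≤? n ∸ y) (≤∸⇒≤∸ jm≤n y≤)) (cong V (∸-comm n y (j * m)))))) ⟩
      sum⁺ (n ∸ j * m) (λ y → c y * W y j)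
        ≡⟨ sym (sum⁺-extend _ n (m∸n≤m n (j * m)) λ y n∸jm<y y≤n →
             trans (cong (c y *_) (when-false (j * m ≤? n ∸ y) λ jm≤ → <⇒≱ n∸jm<y (≤∸⇒≤∸ y≤n jm≤)))
                   (*-zeroʳ (c y))) ⟩
      sum⁺ n (λ y → c y * W y j) ∎
    ... | no jm≰n = sym (sum⁺-zero _ n λ y _ _ → trans (cong (c y *_)
            (when-false (j * m ≤? n ∸ y) λ jm≤ → jm≰n (≤-trans jm≤ (m∸n≤m n y)))) (*-zeroʳ (c y)))

  addPart-tail : ∀ n i → 1 ≤ i →
    sumUpTo (n ∸ i) (λ j → when ((i + j) * m ≤? n) (V (n ∸ (i + j) * m))) ≡ when (i * m ≤? n) (addPart m V (n ∸ i * m))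
  addPart-tail n i 1≤i with i * m ≤? n
  ... | yes im≤n = begin
    sumUpTo (n ∸ i) (λ j → when ((i + j) * m ≤? n) (V (n ∸ (i + j) * m)))
      ≡⟨ sumUpTo-cong (n ∸ i) (λ j _ → when-cong ((i + j) * m ≤? n) (j * m ≤? n ∸ i * m)
           (λ le → m+n≤o⇒m≤o∸n (j * m) (subst (_≤ n) (split j) le))
           (λ le → subst (_≤ n) (sym (split j)) (m≤o∸n⇒m+n≤o (j * m) im≤n le))
           (λ _ → cong V (trans (cong (n ∸_) (trans (split j) (+-comm (j * m) (i * m))))
                                (sym (∸-+-assoc n (i * m) (j * m)))))) ⟩
    sumUpTo (n ∸ i) (λ j → when (j * m ≤? n ∸ i * m) (V (n ∸ i * m ∸ j * m)))
      ≡⟨ addPart-extend (n ∸ i) (∸-monoʳ-≤ n (m≤m*n i m)) ⟩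
    addPart m V (n ∸ i * m) ∎
    where
    open ≡-Reasoning
    split : ∀ j → (i + j) * m ≡ j * m + i * m
    split j = trans (*-distribʳ-+ m i j) (+-comm (i * m) (j * m))
  ... | no im≰n = sumUpTo-zero _ (n ∸ i) λ j _ →
    when-false ((i + j) * m ≤? n) λ le → im≰n (≤-trans (*-monoˡ-≤ m (m≤m+n i j)) le)

  addPart-newPartsWeighted : ∀ n → sumUpTo n (λ j → when (j * m ≤? n) (j * m * V (n ∸ j * m)))
                                   ≡ sum⁺ n (λ y → when (m ∣? y) m * addPart m V (n ∸ y))
  addPart-newPartsWeighted n = begin
    sumUpTo n (λ j → when (j * m ≤? n) (j * m * V (n ∸ j * m)))
      ≡⟨ sumUpTo-cong n (λ j _ → factor j) ⟩
    sumUpTo n (λ j → m * (j * H j))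
      ≡⟨ sym (*-distribˡ-sumUpTo _ m n) ⟩
    m * sumUpTo n (λ j → j * H j)
      ≡⟨ cong (m *_) (sumUpTo≡head+sum⁺ _ n) ⟩
    m * sum⁺ n (λ j → j * H j)
      ≡⟨ cong (m *_) (sum⁺-index-weighted n H) ⟩
    m * sum⁺ n (λ i → sumUpTo (n ∸ i) (λ j → H (i + j)))
      ≡⟨ cong (m *_) (sum⁺-cong n (λ i 1≤i _ → addPart-tail n i 1≤i)) ⟩
    m * sum⁺ n (λ i → when (i * m ≤? n) (addPart m V (n ∸ i * m)))
      ≡⟨ cong (m *_) (sum⁺-multiples m n (λ y → addPart m V (n ∸ y))) ⟩
    m * sum⁺ n (λ y → when (m ∣? y) (addPart m V (n ∸ y)))
      ≡⟨ *-distribˡ-sum⁺ _ m n ⟩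
    sum⁺ n (λ y → m * when (m ∣? y) (addPart m V (n ∸ y)))
      ≡⟨ sum⁺-cong n (λ y _ _ → trans (*-distribˡ-when (m ∣? y) m _) (sym (when-* (m ∣? y) m _))) ⟩
    sum⁺ n (λ y → when (m ∣? y) m * addPart m V (n ∸ y)) ∎
    where
    open ≡-Reasoning
    H : ℕ → ℕ
    H l = when (l * m ≤? n) (V (n ∸ l * m))
    factor : ∀ j → when (j * m ≤? n) (j * m * V (n ∸ j * m)) ≡ m * (j * H j)
    factor j = let v = V (n ∸ j * m) in sym (begin
      m * (j * H j)                              ≡⟨ cong (m *_) (*-distribˡ-when (j * m ≤? n) j _) ⟩
      m * when (j * m ≤? n) (j * V (n ∸ j * m))  ≡⟨ *-distribˡ-when (j * m ≤? n) m _ ⟩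
      when (j * m ≤? n) (m * (j * V (n ∸ j * m))) ≡⟨ when-congʳ (j * m ≤? n) (λ _ → trans (sym (*-assoc m j v)) (cong (_* v) (*-comm m j))) ⟩
      when (j * m ≤? n) (j * m * V (n ∸ j * m)) ∎)

  logDerivative-addPart : ∀ {c} → LogDerivative c V → LogDerivative (λ y → when (m ∣? y) m + c y) (addPart m V)
  logDerivative-addPart {c} V′ n = begin
    n * addPart m V n
      ≡⟨ *-distribˡ-sumUpTo _ n n ⟩
    sumUpTo n (λ j → n * when (j * m ≤? n) (V (n ∸ j * m)))
      ≡⟨ sumUpTo-cong n (λ j _ → splitSize j) ⟩
    sumUpTo n (λ j → when (j * m ≤? n) ((n ∸ j * m) * V (n ∸ j * m)) + when (j * m ≤? n) (j * m * V (n ∸ j * m)))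
      ≡⟨ sumUpTo-+ n ⟩
    sumUpTo n (λ j → when (j * m ≤? n) ((n ∸ j * m) * V (n ∸ j * m)))
      + sumUpTo n (λ j → when (j * m ≤? n) (j * m * V (n ∸ j * m)))
      ≡⟨ cong₂ _+_ (addPart-restWeighted {c} V′ n) (addPart-newPartsWeighted n) ⟩
    sum⁺ n (λ y → c y * U (n ∸ y)) + sum⁺ n (λ y → when (m ∣? y) m * U (n ∸ y))
      ≡⟨ sym (sum⁺-+ n) ⟩
    sum⁺ n (λ y → c y * U (n ∸ y) + when (m ∣? y) m * U (n ∸ y))
      ≡⟨ sum⁺-cong n (λ y _ _ → trans (+-comm (c y * _) _) (sym (*-distribʳ-+ (U (n ∸ y)) (when (m ∣? y) m) (c y)))) ⟩
    sum⁺ n (λ y → (when (m ∣? y) m + c y) * U (n ∸ y)) ∎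
    where
    open ≡-Reasoning
    U : ℕ → ℕ
    U = addPart m V
    -- n = (n − jm) + jm: the size of the rest plus the size of the j new parts.
    splitSize : ∀ j → n * when (j * m ≤? n) (V (n ∸ j * m))
                    ≡ when (j * m ≤? n) ((n ∸ j * m) * V (n ∸ j * m)) + when (j * m ≤? n) (j * m * V (n ∸ j * m))
    splitSize j = trans (*-distribˡ-when (j * m ≤? n) n _) (trans
      (when-congʳ (j * m ≤? n) (λ jm≤n → trans (cong (_* V (n ∸ j * m)) (sym (m∸n+n≡m jm≤n)))
                                               (*-distribʳ-+ (V (n ∸ j * m)) (n ∸ j * m) (j * m))))
      (when-+ (j * m ≤? n) _ _))

divisorWeight : List ℕ → ℕ → ℕ
divisorWeight []       y = 0
divisorWeight (m ∷ ms) y = when (m ∣? y) m + divisorWeight ms y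

ways-logDerivative : ∀ {ts} → All NonZero ts → LogDerivative (divisorWeight ts) (ways ts)
ways-logDerivative {[]}     []            zero    = refl
ways-logDerivative {[]}     []            (suc n) = trans (*-zeroʳ n) (sym (sum⁺-zero _ (suc n) λ _ _ _ → refl))
ways-logDerivative {m ∷ ms} (m≢0 ∷ ms≢0) n = begin
  n * ways (m ∷ ms) n
    ≡⟨ cong (n *_) (ways-∷ m ms n) ⟩
  n * addPart m (ways ms) n
    ≡⟨ logDerivative-addPart m {{m≢0}} (ways ms) (ways-logDerivative ms≢0) n ⟩
  sum⁺ n (λ y → divisorWeight (m ∷ ms) y * addPart m (ways ms) (n ∸ y))
    ≡⟨ sum⁺-cong n (λ y _ _ → cong (divisorWeight (m ∷ ms) y *_) (sym (ways-∷ m ms (n ∸ y)))) ⟩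
  sum⁺ n (λ y → divisorWeight (m ∷ ms) y * ways (m ∷ ms) (n ∸ y)) ∎
  where open ≡-Reasoning

-- The recurrence for p₋ₖ

σ : ℕ → ℕ
σ n = sum⁺ n (λ d → when (d ∣? n) d)

divisorWeight-++ : ∀ xs ys y → divisorWeight (xs ++ ys) y ≡ divisorWeight xs y + divisorWeight ys y
divisorWeight-++ []       ys y = refl
divisorWeight-++ (m ∷ xs) ys y =
  trans (cong (when (m ∣? y) m +_) (divisorWeight-++ xs ys y)) (sym (+-assoc (when (m ∣? y) m) _ _))

divisorWeight-replicate : ∀ k m y → divisorWeight (replicate k m) y ≡ k * when (m ∣? y) m
divisorWeight-replicate zero    m y = refl
divisorWeight-replicate (suc k) m y = cong (when (m ∣? y) m +_) (divisorWeight-replicate k m y)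

divisorWeight-types : ∀ k N y → divisorWeight (types k N) y ≡ k * sum⁺ N (λ d → when (d ∣? y) d)
divisorWeight-types k zero    y = sym (*-zeroʳ k)
divisorWeight-types k (suc N) y = begin
  divisorWeight (replicate k (suc N) ++ types k N) y
    ≡⟨ divisorWeight-++ (replicate k (suc N)) (types k N) y ⟩
  divisorWeight (replicate k (suc N)) y + divisorWeight (types k N) y
    ≡⟨ cong₂ _+_ (divisorWeight-replicate k (suc N) y) (divisorWeight-types k N y) ⟩
  k * when (suc N ∣? y) (suc N) + k * sum⁺ N (λ d → when (d ∣? y) d)
    ≡⟨ +-comm (k * when (suc N ∣? y) (suc N)) _ ⟩
  k * sum⁺ N (λ d → when (d ∣? y) d) + k * when (suc N ∣? y) (suc N)
    ≡⟨ sym (*-distribˡ-+ k _ _) ⟩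
  k * sum⁺ (suc N) (λ d → when (d ∣? y) d) ∎
  where open ≡-Reasoning

divisorSum-extend : ∀ {y} N → 1 ≤ y → y ≤ N → sum⁺ N (λ d → when (d ∣? y) d) ≡ σ y
divisorSum-extend {y} N 1≤y y≤N = sum⁺-extend _ N y≤N λ d y<d _ →
  when-false (d ∣? y) λ d∣y → <⇒≱ y<d (∣⇒≤ {{>-nonZero 1≤y}} d∣y)

types-nonZero : ∀ k N → All NonZero (types k N)
types-nonZero k zero    = []
types-nonZero k (suc N) = ++⁺ (replicate⁺ k _) (types-nonZero k N)

addPart-small : ∀ m V {x} → x < m → addPart m V x ≡ V x
addPart-small m V {x} x<m = begin
  addPart m V x
    ≡⟨ sumUpTo≡head+sum⁺ _ x ⟩
  when (0 ≤? x) (V x) + sum⁺ x (λ j → when (j * m ≤? x) (V (x ∸ j * m)))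
    ≡⟨ cong₂ _+_ (when-true (0 ≤? x) z≤n) (sum⁺-zero _ x λ j 1≤j _ → when-false (j * m ≤? x) λ jm≤x →
         <⇒≱ x<m (≤-trans (m≤n*m m j {{>-nonZero 1≤j}}) jm≤x)) ⟩
  V x + 0
    ≡⟨ +-identityʳ (V x) ⟩
  V x ∎
  where open ≡-Reasoning

ways-replicate-large : ∀ k m ts {x} → x < m → ways (replicate k m ++ ts) x ≡ ways ts x
ways-replicate-large zero    m ts x<m = refl
ways-replicate-large (suc k) m ts {x} x<m =
  trans (trans (ways-∷ m _ x) (addPart-small m (ways (replicate k m ++ ts)) x<m)) (ways-replicate-large k m ts x<m)

ways-types : ∀ k {x} N → x ≤ N → ways (types k N) x ≡ p- k x
ways-types k {x} zero    z≤n = refl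
ways-types k {x} (suc N) x≤N with x ≟ suc N
... | yes refl = refl
... | no  x≢N  = trans (ways-replicate-large k (suc N) (types k N) x<N) (ways-types k N (≤-pred x<N))
  where
  x<N : x < suc N
  x<N = ≤∧≢⇒< x≤N x≢N

p-recurrence : ∀ k n → n * p- k n ≡ k * sum⁺ n (λ j → σ j * p- k (n ∸ j))
p-recurrence k n = begin
  n * p- k n
    ≡⟨ ways-logDerivative (types-nonZero k n) n ⟩
  sum⁺ n (λ j → divisorWeight (types k n) j * ways (types k n) (n ∸ j))
    ≡⟨ sum⁺-cong n (λ j 1≤j j≤n → cong₂ _*_
         (trans (divisorWeight-types k n j) (cong (k *_) (divisorSum-extend n 1≤j j≤n)))
         (ways-types k n (m∸n≤m n j))) ⟩
  sum⁺ n (λ j → k * σ j * p- k (n ∸ j))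
    ≡⟨ sum⁺-cong n (λ j _ _ → *-assoc k (σ j) _) ⟩
  sum⁺ n (λ j → k * (σ j * p- k (n ∸ j)))
    ≡⟨ sym (*-distribˡ-sum⁺ _ k n) ⟩
  k * sum⁺ n (λ j → σ j * p- k (n ∸ j)) ∎
  where open ≡-Reasoning

p-mono-colours : ∀ {k l} → k ≤ l → ∀ n → p- k n ≤ p- l n
p-mono-colours {k} {l} k≤l = <-rec (λ n → p- k n ≤ p- l n) step
  where
  step : ∀ n → (∀ {m} → m < n → p- k m ≤ p- l m) → p- k n ≤ p- l n
  step zero    _  = ≤-refl
  step (suc n) IH = *-cancelˡ-≤ (suc n) (begin
    suc n * p- k (suc n)
      ≡⟨ p-recurrence k (suc n) ⟩
    k * sum⁺ (suc n) (λ j → σ j * p- k (suc n ∸ j))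
      ≤⟨ *-mono-≤ k≤l (sum⁺-mono-≤ (suc n) λ j 1≤j j≤n → *-monoʳ-≤ (σ j) (IH (n∸j<n 1≤j j≤n))) ⟩
    l * sum⁺ (suc n) (λ j → σ j * p- l (suc n ∸ j))
      ≡⟨ sym (p-recurrence l (suc n)) ⟩
    suc n * p- l (suc n) ∎)
    where open ≤-Reasoning

-- Bounds on the divisor sum

n≤σ : ∀ n → n ≤ σ n
n≤σ zero    = z≤n
n≤σ (suc n) = ≤-trans (≤-reflexive (sym (when-true (suc n ∣? suc n) ∣-refl))) (m≤n+m _ _)

gauss : ∀ n → 2 * sum⁺ n (λ d → d) ≡ n * suc n
gauss zero    = refl
gauss (suc n) = begin
  2 * (sum⁺ n (λ d → d) + suc n)       ≡⟨ *-distribˡ-+ 2 (sum⁺ n (λ d → d)) (suc n) ⟩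
  2 * sum⁺ n (λ d → d) + 2 * suc n     ≡⟨ cong (_+ 2 * suc n) (gauss n) ⟩
  n * suc n + 2 * suc n                ≡⟨ step n ⟩
  suc n * suc (suc n)                  ∎
  where
  open ≡-Reasoning
  step : ∀ n → n * suc n + 2 * suc n ≡ suc n * suc (suc n)
  step = solve-∀

σ≤sum⁺-id : ∀ n → σ n ≤ sum⁺ n (λ d → d)
σ≤sum⁺-id n = sum⁺-mono-≤ n λ d _ _ → when-≤ (d ∣? n) d

2σ≤n[n+1] : ∀ n → 2 * σ n ≤ n * suc n
2σ≤n[n+1] n = ≤-trans (*-monoʳ-≤ 2 (σ≤sum⁺-id n)) (≤-reflexive (gauss n))

-- For n ≥ 3, n − 1 does not divide n, so that term of the triangular bound is missing.
2σ+2≤n[n+1] : ∀ n → 3 ≤ n → 2 * σ n + 2 ≤ n * suc n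
2σ+2≤n[n+1] 1                   (s≤s ())
2σ+2≤n[n+1] 2                   (s≤s (s≤s ()))
2σ+2≤n[n+1] (suc (suc (suc t))) _         = begin
  2 * (sum⁺ (1 + t) g + g (2 + t) + g (3 + t)) + 2
    ≡⟨ cong (λ x → 2 * (sum⁺ (1 + t) g + x + g (3 + t)) + 2) (when-false ((2 + t) ∣? (3 + t)) 2+t∤3+t) ⟩
  2 * (sum⁺ (1 + t) g + 0 + g (3 + t)) + 2
    ≤⟨ +-monoˡ-≤ 2 (*-monoʳ-≤ 2 (+-mono-≤ (+-monoˡ-≤ 0 (sum⁺-mono-≤ (1 + t) λ d _ _ → when-≤ (d ∣? 3 + t) d))
                                          (when-≤ ((3 + t) ∣? (3 + t)) (3 + t)))) ⟩
  2 * (sum⁺ (1 + t) (λ d → d) + 0 + (3 + t)) + 2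
    ≡⟨ expand (sum⁺ (1 + t) (λ d → d)) t ⟩
  2 * sum⁺ (1 + t) (λ d → d) + (8 + 2 * t)
    ≡⟨ cong (_+ (8 + 2 * t)) (gauss (1 + t)) ⟩
  (1 + t) * (2 + t) + (8 + 2 * t)
    ≤⟨ m≤m+n _ (2 + 2 * t) ⟩
  (1 + t) * (2 + t) + (8 + 2 * t) + (2 + 2 * t)
    ≡⟨ collect t ⟩
  (3 + t) * (4 + t) ∎
  where
  open ≤-Reasoning
  g : ℕ → ℕ
  g d = when (d ∣? 3 + t) d
  2+t∤3+t : ¬ (2 + t) ∣ (3 + t)
  2+t∤3+t d∣ = case-2+t≡1 (∣1⇒≡1 (∣m+n∣m⇒∣n (subst ((2 + t) ∣_) (+-comm 1 (2 + t)) d∣) ∣-refl))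
    where
    case-2+t≡1 : ¬ 2 + t ≡ 1
    case-2+t≡1 ()
  expand : ∀ S t → 2 * (S + 0 + (3 + t)) + 2 ≡ 2 * S + (8 + 2 * t)
  expand = solve-∀
  collect : ∀ t → (1 + t) * (2 + t) + (8 + 2 * t) + (2 + 2 * t) ≡ (3 + t) * (4 + t)
  collect = solve-∀

-- A cubic lower bound

module CubicLowerBound (f : ℕ → ℕ) (1≤f0 : 1 ≤ f 0)
                       (weighted-bound : ∀ x → 2 * sum⁺ x (λ j → j * f (x ∸ j)) ≤ x * f x) where

  G : ℕ → ℕ
  G x = sum⁺ x (λ j → j * f (x ∸ j))

  F : ℕ → ℕ
  F x = sumUpTo x (λ j → f (x ∸ j))

  G-suc : ∀ x → G (suc x) ≡ G x + F x
  G-suc x = begin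
    G (suc x)
      ≡⟨ sum⁺-suc (λ j → j * f (suc x ∸ j)) x ⟩
    1 * f x + sum⁺ x (λ j → f (x ∸ j) + j * f (x ∸ j))
      ≡⟨ cong (1 * f x +_) (sum⁺-+ x) ⟩
    1 * f x + (sum⁺ x (λ j → f (x ∸ j)) + G x)
      ≡⟨ rearrange (f x) (sum⁺ x (λ j → f (x ∸ j))) (G x) ⟩
    G x + (f x + sum⁺ x (λ j → f (x ∸ j)))
      ≡⟨ cong (G x +_) (sym (sumUpTo≡head+sum⁺ (λ j → f (x ∸ j)) x)) ⟩
    G x + F x ∎
    where
    open ≡-Reasoning
    rearrange : ∀ a b c → 1 * a + (b + c) ≡ c + (a + b)
    rearrange = solve-∀

  F-suc : ∀ x → F (suc x) ≡ f (suc x) + F x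
  F-suc x = begin
    F (suc x)                          ≡⟨ sumUpTo≡head+sum⁺ _ (suc x) ⟩
    f (suc x) + sum⁺ (suc x) (λ j → f (suc x ∸ j))
      ≡⟨ cong (f (suc x) +_) (sum⁺-suc _ x) ⟩
    f (suc x) + (f x + sum⁺ x (λ j → f (x ∸ j)))
      ≡⟨ cong (f (suc x) +_) (sym (sumUpTo≡head+sum⁺ (λ j → f (x ∸ j)) x)) ⟩
    f (suc x) + F x                    ∎
    where open ≡-Reasoning

  cubic-from-G : ∀ x → x * (x + 1) * (x + 2) * (x + 3) ≤ 36 * G x → (x + 1) * (x + 2) * (x + 3) ≤ 18 * f x
  cubic-from-G zero    _ = ≤-trans (≤-by-computation _) (*-monoʳ-≤ 18 1≤f0)
  cubic-from-G (suc x) G-bound = *-cancelˡ-≤ (suc x) (begin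
    suc x * ((suc x + 1) * (suc x + 2) * (suc x + 3)) ≡⟨ reassoc (suc x) ⟩
    suc x * (suc x + 1) * (suc x + 2) * (suc x + 3)   ≤⟨ G-bound ⟩
    36 * G (suc x)                                    ≡⟨ *-assoc 18 2 (G (suc x)) ⟩
    18 * (2 * G (suc x))                              ≤⟨ *-monoʳ-≤ 18 (weighted-bound (suc x)) ⟩
    18 * (suc x * f (suc x))                          ≡⟨ x*[y*z]≡y*[x*z] 18 (suc x) (f (suc x)) ⟩
    suc x * (18 * f (suc x))                          ∎)
    where
    open ≤-Reasoning
    reassoc : ∀ y → y * ((y + 1) * (y + 2) * (y + 3)) ≡ y * (y + 1) * (y + 2) * (y + 3)
    reassoc = solve-∀
    x*[y*z]≡y*[x*z] : ∀ a b c → a * (b * c) ≡ b * (a * c)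
    x*[y*z]≡y*[x*z] = solve-∀

  quadratic-from-cubic : ∀ x → (x + 1) * (x + 2) * (x + 3) ≤ 18 * f x → (x + 1) * (x + 2) ≤ 3 * f x
  quadratic-from-cubic 0 _ = ≤-trans (≤-by-computation _) (*-monoʳ-≤ 3 1≤f0)
  quadratic-from-cubic 1 cubic = *-monoʳ-≤ 3 (*-cancelˡ-< 18 1 (f 1) (≤-trans (≤-by-computation _) cubic))
  quadratic-from-cubic 2 cubic = *-monoʳ-≤ 3 (*-cancelˡ-< 18 3 (f 2) (≤-trans (≤-by-computation _) cubic))
  quadratic-from-cubic (suc (suc (suc t))) cubic = *-cancelˡ-≤ 6 (begin
    6 * ((x + 1) * (x + 2))           ≤⟨ *-monoˡ-≤ ((x + 1) * (x + 2)) (m≤m+n 6 t) ⟩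
    (6 + t) * ((x + 1) * (x + 2))     ≡⟨ reassoc t ⟩
    (x + 1) * (x + 2) * (x + 3)       ≤⟨ cubic ⟩
    18 * f x                          ≡⟨ *-assoc 6 3 (f x) ⟩
    6 * (3 * f x)                     ∎)
    where
    open ≤-Reasoning
    x : ℕ
    x = 3 + t
    reassoc : ∀ t → (6 + t) * ((3 + t + 1) * (3 + t + 2)) ≡ (3 + t + 1) * (3 + t + 2) * (3 + t + 3)
    reassoc = solve-∀

  G-and-F-bounds : ∀ x → x * (x + 1) * (x + 2) * (x + 3) ≤ 36 * G x × (x + 1) * (x + 2) * (x + 3) ≤ 9 * F x
  G-and-F-bounds zero    = z≤n , ≤-trans (≤-by-computation _) (*-monoʳ-≤ 9 1≤f0)
  G-and-F-bounds (suc x) = G-bound , F-bound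
    where
    open ≤-Reasoning
    G-bound : suc x * (suc x + 1) * (suc x + 2) * (suc x + 3) ≤ 36 * G (suc x)
    G-bound = begin
      suc x * (suc x + 1) * (suc x + 2) * (suc x + 3)
        ≡⟨ split x ⟩
      x * (x + 1) * (x + 2) * (x + 3) + 4 * ((x + 1) * (x + 2) * (x + 3))
        ≤⟨ +-mono-≤ (proj₁ (G-and-F-bounds x)) (*-monoʳ-≤ 4 (proj₂ (G-and-F-bounds x))) ⟩
      36 * G x + 4 * (9 * F x)
        ≡⟨ collect (G x) (F x) ⟩
      36 * (G x + F x)
        ≡⟨ cong (36 *_) (sym (G-suc x)) ⟩
      36 * G (suc x) ∎
      where
      split : ∀ x → suc x * (suc x + 1) * (suc x + 2) * (suc x + 3)
                  ≡ x * (x + 1) * (x + 2) * (x + 3) + 4 * ((x + 1) * (x + 2) * (x + 3))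
      split = solve-∀
      collect : ∀ g h → 36 * g + 4 * (9 * h) ≡ 36 * (g + h)
      collect = solve-∀
    F-bound : (suc x + 1) * (suc x + 2) * (suc x + 3) ≤ 9 * F (suc x)
    F-bound = begin
      (suc x + 1) * (suc x + 2) * (suc x + 3)
        ≡⟨ split x ⟩
      (x + 1) * (x + 2) * (x + 3) + 3 * ((suc x + 1) * (suc x + 2))
        ≤⟨ +-mono-≤ (proj₂ (G-and-F-bounds x)) (*-monoʳ-≤ 3 (quadratic-from-cubic (suc x) (cubic-from-G (suc x) G-bound))) ⟩
      9 * F x + 3 * (3 * f (suc x))
        ≡⟨ collect (f (suc x)) (F x) ⟩
      9 * (f (suc x) + F x)
        ≡⟨ cong (9 *_) (sym (F-suc x)) ⟩
      9 * F (suc x) ∎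
      where
      split : ∀ x → (suc x + 1) * (suc x + 2) * (suc x + 3) ≡ (x + 1) * (x + 2) * (x + 3) + 3 * ((suc x + 1) * (suc x + 2))
      split = solve-∀
      collect : ∀ a b → 9 * b + 3 * (3 * a) ≡ 9 * (a + b)
      collect = solve-∀

  cubic-lower-bound : ∀ x → (x + 1) * (x + 2) * (x + 3) ≤ 18 * f x
  cubic-lower-bound x = cubic-from-G x (proj₁ (G-and-F-bounds x))

-- Submultiplicativity

[a+i][a+i+1]≤i[a+1][a+2] : ∀ a i → 1 ≤ i → i ≤ a → (a + i) * suc (a + i) ≤ i * ((a + 1) * (a + 2))
[a+i][a+i+1]≤i[a+1][a+2] a (suc t) _ i≤a = subst (λ a → (a + suc t) * suc (a + suc t) ≤ suc t * ((a + 1) * (a + 2)))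
                                         (m+[n∸m]≡n i≤a) (bound t (a ∸ suc t))
  where
  expand : ∀ t u → (suc t + u + suc t) * suc (suc t + u + suc t) + t * ((suc t + u) * (suc t + u) + u)
                 ≡ suc t * ((suc t + u + 1) * (suc t + u + 2))
  expand = solve-∀
  bound : ∀ t u → (suc t + u + suc t) * suc (suc t + u + suc t) ≤ suc t * ((suc t + u + 1) * (suc t + u + 2))
  bound t u = ≤-trans (m≤m+n _ _) (≤-reflexive (expand t u))

module Submultiplicativity (k : ℕ) (2≤k : 2 ≤ k) where

  p : ℕ → ℕ
  p = p- k

  p[1]≡k : p 1 ≡ k
  p[1]≡k = trans (sym (*-identityˡ (p 1))) (trans (p-recurrence k 1) (*-identityʳ k))

  weighted-bound : ∀ x → 2 * sum⁺ x (λ j → j * p (x ∸ j)) ≤ x * p x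
  weighted-bound x = begin
    2 * sum⁺ x (λ j → j * p (x ∸ j))    ≤⟨ *-mono-≤ 2≤k (sum⁺-mono-≤ x λ j _ _ → *-monoˡ-≤ (p (x ∸ j)) (n≤σ j)) ⟩
    k * sum⁺ x (λ j → σ j * p (x ∸ j))  ≡⟨ sym (p-recurrence k x) ⟩
    x * p x                             ∎
    where open ≤-Reasoning

  open CubicLowerBound p (s≤s z≤n) weighted-bound using (cubic-lower-bound)

  1≤p : ∀ x → 1 ≤ p x
  1≤p x = *-cancelˡ-< 18 0 (p x) (≤-trans (subst (1 ≤_) (expand x) (s≤s z≤n)) (cubic-lower-bound x))
    where
    expand : ∀ x → 6 + x * (x * x + 6 * x + 11) ≡ (x + 1) * (x + 2) * (x + 3)
    expand = solve-∀

  quadratic-lower-bound : ∀ a → 3 ≤ a → (a + 1) * (a + 2) ≤ 2 * p a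
  quadratic-lower-bound 1 (s≤s ())
  quadratic-lower-bound 2 (s≤s (s≤s ()))
  quadratic-lower-bound 3 _ = ≤-trans (≤-by-computation _) (*-monoʳ-≤ 2 (p-mono-colours 2≤k 3))
  quadratic-lower-bound 4 _ = ≤-trans (≤-by-computation _) (*-monoʳ-≤ 2 (p-mono-colours 2≤k 4))
  quadratic-lower-bound 5 _ = ≤-trans (≤-by-computation _) (*-monoʳ-≤ 2 (p-mono-colours 2≤k 5))
  quadratic-lower-bound (suc (suc (suc (suc (suc (suc t)))))) _ = *-cancelˡ-≤ 9 (begin
    9 * ((a + 1) * (a + 2))        ≤⟨ *-monoˡ-≤ ((a + 1) * (a + 2)) (m≤m+n 9 t) ⟩
    (9 + t) * ((a + 1) * (a + 2))  ≡⟨ reassoc t ⟩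
    (a + 1) * (a + 2) * (a + 3)    ≤⟨ cubic-lower-bound a ⟩
    18 * p a                       ≡⟨ *-assoc 9 2 (p a) ⟩
    9 * (2 * p a)                  ∎)
    where
    open ≤-Reasoning
    a : ℕ
    a = 6 + t
    reassoc : ∀ t → (9 + t) * ((6 + t + 1) * (6 + t + 2)) ≡ (6 + t + 1) * (6 + t + 2) * (6 + t + 3)
    reassoc = solve-∀

  σ-shift<σ*p : ∀ a i → 1 ≤ i → i ≤ a → (a ≡ 1 → 4 ≤ k) → σ (a + i) < σ i * p a
  σ-shift<σ*p 1 1 _ _ 4≤k = ≤-trans (4≤k refl) (≤-reflexive (sym (trans (*-identityˡ (p 1)) p[1]≡k)))
  σ-shift<σ*p 1 (suc (suc _)) _ (s≤s ()) _
  σ-shift<σ*p 2 (suc (suc (suc _))) _ (s≤s (s≤s ())) _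
  σ-shift<σ*p 2 1 _ _ _   = ≤-trans (p-mono-colours 2≤k 2) (≤-reflexive (sym (*-identityˡ (p 2))))
  σ-shift<σ*p 2 2 _ _ _   = begin-strict
    σ 4          <⟨ ≤-by-computation _ ⟩
    3 * p- 2 2   ≤⟨ *-monoʳ-≤ 3 (p-mono-colours 2≤k 2) ⟩
    3 * p 2      ∎
    where open ≤-Reasoning
  σ-shift<σ*p a@(suc (suc (suc _))) i 1≤i i≤a _ = *-cancelˡ-< 2 _ _ (begin-strict
    2 * σ (a + i)             <⟨ m<m+n _ (s≤s z≤n) ⟩
    2 * σ (a + i) + 2         ≤⟨ 2σ+2≤n[n+1] (a + i) (≤-trans (s≤s (s≤s (s≤s z≤n))) (m≤m+n a i)) ⟩
    (a + i) * suc (a + i)     ≤⟨ [a+i][a+i+1]≤i[a+1][a+2] a i 1≤i i≤a ⟩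
    i * ((a + 1) * (a + 2))   ≤⟨ *-mono-≤ (n≤σ i) (quadratic-lower-bound a (s≤s (s≤s (s≤s z≤n)))) ⟩
    σ i * (2 * p a)           ≡⟨ x*[y*z]≡y*[x*z] (σ i) 2 (p a) ⟩
    2 * (σ i * p a)           ∎)
    where
    open ≤-Reasoning
    x*[y*z]≡y*[x*z] : ∀ x y z → x * (y * z) ≡ y * (x * z)
    x*[y*z]≡y*[x*z] = solve-∀

  Exceptional : ℕ → ℕ → Set
  Exceptional a b = (a ≡ 1 × b ≡ 1 × k ≡ 2) ⊎ (a ≡ 2 × b ≡ 1 × k ≡ 2) ⊎ (a ≡ 3 × b ≡ 1 × k ≡ 2) ⊎ (a ≡ 1 × b ≡ 1 × k ≡ 3)

  -- The non-strict inequality fails only at p₋₂(2) = 5 > 4 = p₋₂(1)².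
  SubmultiplicativeBelow : ℕ → Set
  SubmultiplicativeBelow N = ∀ x y → x + y < N → ¬ (k ≡ 2 × x ≡ 1 × y ≡ 1) → p (x + y) ≤ p x * p y

  head-bound : ∀ a b n → n ≤ a → SubmultiplicativeBelow (a + b) →
               (∀ j → 1 ≤ j → j ≤ n → ¬ (k ≡ 2 × a ∸ j ≡ 1 × b ≡ 1)) →
               sum⁺ n (λ j → σ j * p (a + b ∸ j)) ≤ p b * sum⁺ n (λ j → σ j * p (a ∸ j))
  head-bound a b n n≤a IH allowed = begin
    sum⁺ n (λ j → σ j * p (a + b ∸ j))        ≤⟨ sum⁺-mono-≤ n term ⟩
    sum⁺ n (λ j → p b * (σ j * p (a ∸ j)))    ≡⟨ sym (*-distribˡ-sum⁺ _ (p b) n) ⟩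
    p b * sum⁺ n (λ j → σ j * p (a ∸ j))      ∎
    where
    open ≤-Reasoning
    x*[y*z]≡z*[x*y] : ∀ x y z → x * (y * z) ≡ z * (x * y)
    x*[y*z]≡z*[x*y] = solve-∀
    term : ∀ j → 1 ≤ j → j ≤ n → σ j * p (a + b ∸ j) ≤ p b * (σ j * p (a ∸ j))
    term j 1≤j j≤n = begin
      σ j * p (a + b ∸ j)      ≡⟨ cong (λ m → σ j * p m) (+-∸-comm b j≤a) ⟩
      σ j * p (a ∸ j + b)      ≤⟨ *-monoʳ-≤ (σ j) (IH (a ∸ j) b (+-monoˡ-< b (n∸j<n 1≤j j≤a)) (allowed j 1≤j j≤n)) ⟩
      σ j * (p (a ∸ j) * p b)  ≡⟨ x*[y*z]≡z*[x*y] (σ j) (p (a ∸ j)) (p b) ⟩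
      p b * (σ j * p (a ∸ j))  ∎
      where
      j≤a : j ≤ a
      j≤a = ≤-trans j≤n n≤a

  tail-bound : ∀ a b → 1 ≤ b → (∀ i → 1 ≤ i → i ≤ b → σ (a + i) < σ i * p a) →
               sum⁺ b (λ i → σ (a + i) * p (b ∸ i)) < p a * sum⁺ b (λ i → σ i * p (b ∸ i))
  tail-bound a b 1≤b σ< = begin-strict
    sum⁺ b (λ i → σ (a + i) * p (b ∸ i))
      <⟨ sum⁺-mono-< b 1≤b (λ i 1≤i i≤b → *-monoˡ-< (p (b ∸ i)) {{>-nonZero (1≤p (b ∸ i))}} (σ< i 1≤i i≤b)) ⟩
    sum⁺ b (λ i → σ i * p a * p (b ∸ i))
      ≡⟨ sum⁺-cong b (λ i _ _ → x*y*z≡y*[x*z] (σ i) (p a) (p (b ∸ i))) ⟩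
    sum⁺ b (λ i → p a * (σ i * p (b ∸ i)))
      ≡⟨ sym (*-distribˡ-sum⁺ _ (p a) b) ⟩
    p a * sum⁺ b (λ i → σ i * p (b ∸ i)) ∎
    where
    open ≤-Reasoning
    x*y*z≡y*[x*z] : ∀ x y z → x * y * z ≡ y * (x * z)
    x*y*z≡y*[x*z] = solve-∀

  σ-shift<⇒strict : ∀ a b → 1 ≤ b → b ≤ a → SubmultiplicativeBelow (a + b) → ¬ (k ≡ 2 × b ≡ 1) →
                   (∀ i → 1 ≤ i → i ≤ b → σ (a + i) < σ i * p a) → p (a + b) < p a * p b
  σ-shift<⇒strict a b 1≤b b≤a IH not-k2-b1 σ< = *-cancelˡ-< (a + b) _ _ (begin-strict
    (a + b) * p (a + b)
      ≡⟨ p-recurrence k (a + b) ⟩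
    k * sum⁺ (a + b) (λ j → σ j * p (a + b ∸ j))
      ≡⟨ cong (k *_) (sum⁺-+-range _ a b) ⟩
    k * (sum⁺ a (λ j → σ j * p (a + b ∸ j)) + sum⁺ b (λ i → σ (a + i) * p (a + b ∸ (a + i))))
      ≡⟨ cong (λ x → k * (sum⁺ a (λ j → σ j * p (a + b ∸ j)) + x))
              (sum⁺-cong b λ i _ _ → cong (λ m → σ (a + i) * p m) ([m+n]∸[m+o]≡n∸o a b i)) ⟩
    k * (sum⁺ a (λ j → σ j * p (a + b ∸ j)) + sum⁺ b (λ i → σ (a + i) * p (b ∸ i)))
      <⟨ *-monoʳ-< k {{>-nonZero (≤-trans (s≤s z≤n) 2≤k)}}
           (+-mono-≤-< (head-bound a b a ≤-refl IH λ _ _ _ (k≡2 , _ , b≡1) → not-k2-b1 (k≡2 , b≡1))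
                       (tail-bound a b 1≤b σ<)) ⟩
    k * (p b * R a + p a * R b)
      ≡⟨ distribute k (p b) (p a) (R a) (R b) ⟩
    p b * (k * R a) + p a * (k * R b)
      ≡⟨ cong₂ (λ u v → p b * u + p a * v) (sym (p-recurrence k a)) (sym (p-recurrence k b)) ⟩
    p b * (a * p a) + p a * (b * p b)
      ≡⟨ collect a b (p a) (p b) ⟩
    (a + b) * (p a * p b) ∎)
    where
    open ≤-Reasoning
    R : ℕ → ℕ
    R n = sum⁺ n (λ j → σ j * p (n ∸ j))
    distribute : ∀ k x y A B → k * (x * A + y * B) ≡ x * (k * A) + y * (k * B)
    distribute = solve-∀
    collect : ∀ a b x y → y * (a * x) + x * (b * y) ≡ (a + b) * (x * y)
    collect = solve-∀

  σ-neighbours<p : ∀ t → σ (12 + t) + σ (14 + t) < p (13 + t)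
  σ-neighbours<p t = *-cancelˡ-< 18 _ _ (begin-strict
    18 * (σ (12 + t) + σ (14 + t))
      ≡⟨ regroup (σ (12 + t)) (σ (14 + t)) ⟩
    9 * (2 * σ (12 + t) + 2 * σ (14 + t))
      ≤⟨ *-monoʳ-≤ 9 (+-mono-≤ (2σ≤n[n+1] (12 + t)) (2σ≤n[n+1] (14 + t))) ⟩
    9 * ((12 + t) * suc (12 + t) + (14 + t) * suc (14 + t))
      <⟨ ≤-trans (m≤m+n _ _) (≤-reflexive (expand t)) ⟩
    (13 + t + 1) * (13 + t + 2) * (13 + t + 3)
      ≤⟨ cubic-lower-bound (13 + t) ⟩
    18 * p (13 + t) ∎)
    where
    open ≤-Reasoning
    regroup : ∀ x y → 18 * (x + y) ≡ 9 * (2 * x + 2 * y)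
    regroup = solve-∀
    expand : ∀ t → suc (9 * ((12 + t) * suc (12 + t) + (14 + t) * suc (14 + t))) + (t * t * t + 27 * (t * t) + 188 * t + 65)
                 ≡ (13 + t + 1) * (13 + t + 2) * (13 + t + 3)
    expand = solve-∀

  module _ (k≡2 : k ≡ 2) where

    p[1]≡2 : p 1 ≡ 2
    p[1]≡2 = trans p[1]≡k k≡2

    p[2]≡5 : p 2 ≡ 5
    p[2]≡5 = cong (λ l → p- l 2) k≡2

    lowTerms : ℕ → ℕ
    lowTerms t = sum⁺ (11 + t) (λ j → σ j * p (13 + t ∸ j))

    a*p[a]≡ : ∀ t → (13 + t) * p (13 + t) ≡ 2 * (lowTerms t + σ (12 + t) * 2 + σ (13 + t) * 1)
    a*p[a]≡ t = begin
      (13 + t) * p (13 + t)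
        ≡⟨ p-recurrence k (13 + t) ⟩
      k * (lowTerms t + σ (12 + t) * p (13 + t ∸ (12 + t)) + σ (13 + t) * p (13 + t ∸ (13 + t)))
        ≡⟨ cong₂ (λ u v → k * (lowTerms t + σ (12 + t) * p u + σ (13 + t) * p v))
                 (m+n∸n≡m 1 (12 + t)) (n∸n≡0 (13 + t)) ⟩
      k * (lowTerms t + σ (12 + t) * p 1 + σ (13 + t) * 1)
        ≡⟨ cong₂ (λ u v → u * (lowTerms t + σ (12 + t) * v + σ (13 + t) * 1)) k≡2 p[1]≡2 ⟩
      2 * (lowTerms t + σ (12 + t) * 2 + σ (13 + t) * 1) ∎
      where open ≡-Reasoning

    [a+1]*p[a+1]≤ : ∀ t → SubmultiplicativeBelow (13 + t + 1) →
      (14 + t) * p (14 + t) ≤ 2 * (2 * lowTerms t + σ (12 + t) * 5 + σ (13 + t) * 2 + σ (14 + t) * 1)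
    [a+1]*p[a+1]≤ t IH = begin
      (14 + t) * p (14 + t)
        ≡⟨ p-recurrence k (14 + t) ⟩
      k * (sum⁺ (11 + t) g + σ (12 + t) * p (14 + t ∸ (12 + t)) + σ (13 + t) * p (14 + t ∸ (13 + t))
           + σ (14 + t) * p (14 + t ∸ (14 + t)))
        ≡⟨ cong₂ (λ u v → k * (sum⁺ (11 + t) g + σ (12 + t) * p u + σ (13 + t) * p v + σ (14 + t) * p (14 + t ∸ (14 + t))))
                 (m+n∸n≡m 2 (12 + t)) (m+n∸n≡m 1 (13 + t)) ⟩
      k * (sum⁺ (11 + t) g + σ (12 + t) * p 2 + σ (13 + t) * p 1 + σ (14 + t) * p (14 + t ∸ (14 + t)))
        ≡⟨ cong (λ v → k * (sum⁺ (11 + t) g + σ (12 + t) * p 2 + σ (13 + t) * p 1 + σ (14 + t) * p v)) (n∸n≡0 (14 + t)) ⟩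
      k * (sum⁺ (11 + t) g + σ (12 + t) * p 2 + σ (13 + t) * p 1 + σ (14 + t) * 1)
        ≤⟨ *-monoʳ-≤ k (+-monoˡ-≤ _ (+-monoˡ-≤ _ (+-monoˡ-≤ _ head))) ⟩
      k * (p 1 * lowTerms t + σ (12 + t) * p 2 + σ (13 + t) * p 1 + σ (14 + t) * 1)
        ≡⟨ cong₂ (λ u v → u * (v * lowTerms t + σ (12 + t) * p 2 + σ (13 + t) * v + σ (14 + t) * 1)) k≡2 p[1]≡2 ⟩
      2 * (2 * lowTerms t + σ (12 + t) * p 2 + σ (13 + t) * 2 + σ (14 + t) * 1)
        ≡⟨ cong (λ u → 2 * (2 * lowTerms t + σ (12 + t) * u + σ (13 + t) * 2 + σ (14 + t) * 1)) p[2]≡5 ⟩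
      2 * (2 * lowTerms t + σ (12 + t) * 5 + σ (13 + t) * 2 + σ (14 + t) * 1) ∎
      where
      open ≤-Reasoning
      g : ℕ → ℕ
      g j = σ j * p (14 + t ∸ j)
      head : sum⁺ (11 + t) g ≤ p 1 * lowTerms t
      head = subst (λ m → sum⁺ (11 + t) (λ j → σ j * p (m ∸ j)) ≤ p 1 * lowTerms t) (+-comm (13 + t) 1)
               (head-bound (13 + t) 1 (11 + t) (≤-trans (n≤1+n _) (n≤1+n _)) IH λ j _ j≤ (_ , a∸j≡1 , _) →
                  <⇒≱ (≤-trans (≤-reflexive (sym (m+n∸n≡m 2 (11 + t)))) (∸-monoʳ-≤ (13 + t) j≤)) (≤-reflexive a∸j≡1))

    -- With a = 13 + t, the bound above exceeds 2·a·p(a) by 2(σ(a − 1) + σ(a + 1)), which is below 2·p(a).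
    strict-b1-large : ∀ t → SubmultiplicativeBelow (13 + t + 1) → p (14 + t) < p (13 + t) * p 1
    strict-b1-large t IH = *-cancelˡ-< (14 + t) _ _ (begin-strict
      (14 + t) * p (14 + t)
        ≤⟨ [a+1]*p[a+1]≤ t IH ⟩
      2 * (2 * X + σ (12 + t) * 5 + σ (13 + t) * 2 + σ (14 + t) * 1)
        ≡⟨ regroup X (σ (12 + t)) (σ (13 + t)) (σ (14 + t)) ⟩
      2 * (2 * (X + σ (12 + t) * 2 + σ (13 + t) * 1)) + 2 * (σ (12 + t) + σ (14 + t))
        <⟨ +-monoʳ-< (2 * (2 * (X + σ (12 + t) * 2 + σ (13 + t) * 1))) (*-monoʳ-< 2 (σ-neighbours<p t)) ⟩
      2 * (2 * (X + σ (12 + t) * 2 + σ (13 + t) * 1)) + 2 * p (13 + t)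
        ≡⟨ cong (λ u → 2 * u + 2 * p (13 + t)) (sym (a*p[a]≡ t)) ⟩
      2 * ((13 + t) * p (13 + t)) + 2 * p (13 + t)
        ≡⟨ collect t (p (13 + t)) ⟩
      (14 + t) * (p (13 + t) * 2)
        ≡⟨ cong (λ u → (14 + t) * (p (13 + t) * u)) (sym p[1]≡2) ⟩
      (14 + t) * (p (13 + t) * p 1) ∎)
      where
      open ≤-Reasoning
      X : ℕ
      X = lowTerms t
      regroup : ∀ X x y z → 2 * (2 * X + x * 5 + y * 2 + z * 1) ≡ 2 * (2 * (X + x * 2 + y * 1)) + 2 * (x + z)
      regroup = solve-∀
      collect : ∀ t y → 2 * ((13 + t) * y) + 2 * y ≡ (14 + t) * (y * 2)
      collect = solve-∀

    by-computation : ∀ a → True (suc (p- 2 (a + 1)) ≤? p- 2 a * p- 2 1) → p (a + 1) < p a * p 1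
    by-computation a ok = subst (λ l → p- l (a + 1) < p- l a * p- l 1) (sym k≡2) (toWitness ok)

    strict-b1 : ∀ a → 4 ≤ a → SubmultiplicativeBelow (a + 1) → p (a + 1) < p a * p 1
    strict-b1 1  (s≤s ()) _
    strict-b1 2  (s≤s (s≤s ())) _
    strict-b1 3  (s≤s (s≤s (s≤s ()))) _
    strict-b1 4  _ _ = by-computation 4 _
    strict-b1 5  _ _ = by-computation 5 _
    strict-b1 6  _ _ = by-computation 6 _
    strict-b1 7  _ _ = by-computation 7 _
    strict-b1 8  _ _ = by-computation 8 _
    strict-b1 9  _ _ = by-computation 9 _
    strict-b1 10 _ _ = by-computation 10 _
    strict-b1 11 _ _ = by-computation 11 _
    strict-b1 12 _ _ = by-computation 12 _
    strict-b1 (suc (suc (suc (suc (suc (suc (suc (suc (suc (suc (suc (suc (suc t))))))))))))) _ IH =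
      subst (λ m → p m < p (13 + t) * p 1) (sym (+-comm (13 + t) 1)) (strict-b1-large t IH)

  4≤k : k ≢ 2 → k ≢ 3 → 4 ≤ k
  4≤k k≢2 k≢3 = ≤∧≢⇒< (≤∧≢⇒< 2≤k (k≢2 ∘ sym)) (k≢3 ∘ sym)

  4≤a : k ≡ 2 → ∀ a → 1 ≤ a → ¬ Exceptional a 1 → 4 ≤ a
  4≤a k≡2 1 _ not-exc = contradiction (inj₁ (refl , refl , k≡2)) not-exc
  4≤a k≡2 2 _ not-exc = contradiction (inj₂ (inj₁ (refl , refl , k≡2))) not-exc
  4≤a k≡2 3 _ not-exc = contradiction (inj₂ (inj₂ (inj₁ (refl , refl , k≡2)))) not-exc
  4≤a k≡2 (suc (suc (suc (suc _)))) _ _ = s≤s (s≤s (s≤s (s≤s z≤n)))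

  strict-unless-k2-b1 : ∀ a b → 1 ≤ b → b ≤ a → ¬ Exceptional a b → SubmultiplicativeBelow (a + b) →
                        ¬ (k ≡ 2 × b ≡ 1) → p (a + b) < p a * p b
  strict-unless-k2-b1 a b 1≤b b≤a not-exc IH not-k2-b1 = σ-shift<⇒strict a b 1≤b b≤a IH not-k2-b1 λ i 1≤i i≤b →
    σ-shift<σ*p a i 1≤i (≤-trans i≤b b≤a) λ a≡1 →
      let b≡1 = ≤-antisym (subst (b ≤_) a≡1 b≤a) 1≤b in
      4≤k (λ k≡2 → not-k2-b1 (k≡2 , b≡1)) (λ k≡3 → not-exc (inj₂ (inj₂ (inj₂ (a≡1 , b≡1 , k≡3)))))

  strict : ∀ a b → 1 ≤ b → b ≤ a → ¬ Exceptional a b → SubmultiplicativeBelow (a + b) → p (a + b) < p a * p b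
  strict a b 1≤b b≤a not-exc IH with k ≟ 2 | b ≟ 1
  ... | yes k≡2 | yes refl = strict-b1 k≡2 a (4≤a k≡2 a b≤a not-exc) IH
  ... | no  k≢2 | _        = strict-unless-k2-b1 a b 1≤b b≤a not-exc IH λ (k≡2 , _) → k≢2 k≡2
  ... | yes _   | no  b≢1  = strict-unless-k2-b1 a b 1≤b b≤a not-exc IH λ (_ , b≡1) → b≢1 b≡1

  exceptional? : ∀ a b → Dec (Exceptional a b)
  exceptional? a b = ((a ≟ 1) ×-dec (b ≟ 1) ×-dec (k ≟ 2)) ⊎-dec ((a ≟ 2) ×-dec (b ≟ 1) ×-dec (k ≟ 2))
                     ⊎-dec ((a ≟ 3) ×-dec (b ≟ 1) ×-dec (k ≟ 2)) ⊎-dec ((a ≟ 1) ×-dec (b ≟ 1) ×-dec (k ≟ 3))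

  weak-by-computation : ∀ {l} → k ≡ l → ∀ x y → True (p- l (x + y) ≤? p- l x * p- l y) → p (x + y) ≤ p x * p y
  weak-by-computation k≡l x y ok = subst (λ l → p- l (x + y) ≤ p- l x * p- l y) (sym k≡l) (toWitness ok)

  -- At the three exceptions other than (1, 1, 2), equality holds.
  weak-ordered : ∀ x y → 1 ≤ y → y ≤ x → ¬ (k ≡ 2 × x ≡ 1 × y ≡ 1) → SubmultiplicativeBelow (x + y) →
                 p (x + y) ≤ p x * p y
  weak-ordered x y 1≤y y≤x allowed IH with exceptional? x y
  ... | no  not-exc = <⇒≤ (strict x y 1≤y y≤x not-exc IH)
  ... | yes (inj₁ (x≡1 , y≡1 , k≡2))                 = contradiction (k≡2 , x≡1 , y≡1) allowed
  ... | yes (inj₂ (inj₁ (refl , refl , k≡2)))        = weak-by-computation k≡2 2 1 _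
  ... | yes (inj₂ (inj₂ (inj₁ (refl , refl , k≡2)))) = weak-by-computation k≡2 3 1 _
  ... | yes (inj₂ (inj₂ (inj₂ (refl , refl , k≡3)))) = weak-by-computation k≡3 1 1 _

  weak : ∀ x y → SubmultiplicativeBelow (x + y) → ¬ (k ≡ 2 × x ≡ 1 × y ≡ 1) → p (x + y) ≤ p x * p y
  weak x       zero    _  _       = subst (λ m → p m ≤ p x * 1) (sym (+-identityʳ x)) (≤-reflexive (sym (*-identityʳ (p x))))
  weak zero    (suc y) _  _       = ≤-reflexive (sym (+-identityʳ (p (suc y))))
  weak (suc x) (suc y) IH allowed with suc y ≤? suc x
  ... | yes y≤x = weak-ordered (suc x) (suc y) (s≤s z≤n) y≤x allowed IH
  ... | no  y≰x = subst₂ (λ m n → p m ≤ n) (+-comm (suc y) (suc x)) (*-comm (p (suc y)) (p (suc x)))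
                    (weak-ordered (suc y) (suc x) (s≤s z≤n) (<⇒≤ (≰⇒> y≰x))
                                  (λ (k≡2 , y≡1 , x≡1) → allowed (k≡2 , x≡1 , y≡1))
                                  (subst SubmultiplicativeBelow (+-comm (suc x) (suc y)) IH))

  submultiplicative : ∀ N → SubmultiplicativeBelow N
  submultiplicative zero    x y ()
  submultiplicative (suc N) x y x+y<1+N with m≤n⇒m<n∨m≡n (≤-pred x+y<1+N)
  ... | inj₁ x+y<N = submultiplicative N x y x+y<N
  ... | inj₂ x+y≡N = weak x y (subst SubmultiplicativeBelow (sym x+y≡N) (submultiplicative N))

theorem1p2 : (k a b : ℕ) → 2 ≤ k → 1 ≤ b → b ≤ a →
    ¬ ((a ≡ 1 × b ≡ 1 × k ≡ 2) ⊎ (a ≡ 2 × b ≡ 1 × k ≡ 2) ⊎ (a ≡ 3 × b ≡ 1 × k ≡ 2) ⊎ (a ≡ 1 × b ≡ 1 × k ≡ 3)) →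
    p- k (a + b) < p- k a * p- k b
theorem1p2 k a b 2≤k 1≤b b≤a not-exceptional = strict a b 1≤b b≤a not-exceptional (submultiplicative (a + b))
  where open Submultiplicativity k 2≤k
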